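{- For every tree $t$ on $n$ vertices with vertex degrees $k_1,\dots,k_n$, $$D_{min}^t \ge D_0^t = \frac{1}{4}\left(\frac{n}{2}\langle k^2\rangle + 2(n-1) + \frac{1}{2}q\right),$$ where $\langle k^2\rangle = \frac{1}{n}\sum_{i=1}^n k_i^2$ and $q=\sum_{i=1}^n (k_i \bmod 2)$ is the number of vertices of odd degree.
   Context: A linear arrangement of a graph on $n$ vertices is a bijection $\pi$ from its vertex set to $\{1,\dots,n\}$; the sum of edge lengths is $D(\pi)=\sum_{\{u,v\}\in E}|\pi(u)-\pi(v)|$, and $D_{min}^t$ is the minimum of $D(\pi)$ over all linear arrangements of the tree $t$. -}

module Defs where

open import Data.Nat using (ℕ; zero; suc; _+_; _*_; _∸_; _≤_; _%_; ∣_-_∣)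
open import Data.Fin using (Fin; toℕ; _≟_)
open import Data.List using (List; []; _∷_; map; length; _∷ʳ_)
open import Data.Nat.ListAction using (sum)
open import Data.List.Membership.Propositional using (_∈_)
open import Data.List.Relation.Unary.All using (All)
open import Data.List.Relation.Unary.AllPairs using (AllPairs)
open import Data.List.Relation.Unary.Unique.Propositional using (Unique)
open import Data.List.Relation.Unary.Linked using (Linked)
open import Data.Product using (_×_; _,_; Σ; ∃)
open import Data.Sum using (_⊎_)
open import Relation.Nullary using (¬_; Dec; yes; no)
open import Relation.Binary.PropositionalEquality using (_≡_; _≢_)
open import Relation.Binary.Construct.Closure.ReflexiveTransitive using (Star)
open import Function.Bundles using (_↔_; Inverse)

-- A graph on the vertex set Fin n is given by a list of edges {u,v},
-- each stored as an (unordered, by convention) pair.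
Edge : ℕ → Set
Edge n = Fin n × Fin n

Adj : ∀ {n} → List (Edge n) → Fin n → Fin n → Set
Adj E u v = ((u , v) ∈ E) ⊎ ((v , u) ∈ E)

SameEdge : ∀ {n} → Edge n → Edge n → Set
SameEdge (a , b) (c , d) = ((a ≡ c) × (b ≡ d)) ⊎ ((a ≡ d) × (b ≡ c))

Simple : ∀ {n} → List (Edge n) → Set
Simple E = All (λ e → Data.Product.proj₁ e ≢ Data.Product.proj₂ e) E
         × AllPairs (λ e f → ¬ SameEdge e f) E

Connected : ∀ {n} → List (Edge n) → Set
Connected {n} E = (u v : Fin n) → Star (Adj E) u v

HasCycle : ∀ {n} → List (Edge n) → Set
HasCycle {n} E =
  Σ (Fin n) λ v → Σ (List (Fin n)) λ ws →
    (2 ≤ length ws) × Unique (v ∷ ws) × Linked (Adj E) ((v ∷ ws) ∷ʳ v)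

Acyclic : ∀ {n} → List (Edge n) → Set
Acyclic E = ¬ HasCycle E

IsTree : ∀ {n} → List (Edge n) → Set
IsTree E = Simple E × Connected E × Acyclic E

[_≟v_] : ∀ {n} → Fin n → Fin n → ℕ
[ a ≟v v ] with a ≟ v
... | yes _ = 1
... | no _  = 0

degree : ∀ {n} → List (Edge n) → Fin n → ℕ
degree E v = sum (map (λ e → [ Data.Product.proj₁ e ≟v v ] + [ Data.Product.proj₂ e ≟v v ]) E)

ΣV : (n : ℕ) → (Fin n → ℕ) → ℕ
ΣV zero f = 0
ΣV (suc n) f = f Data.Fin.zero + ΣV n (λ i → f (Data.Fin.suc i))

sumSqDeg : ∀ {n} → List (Edge n) → ℕ
sumSqDeg {n} E = ΣV n (λ v → degree E v * degree E v)

numOddDeg : ∀ {n} → List (Edge n) → ℕ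
numOddDeg {n} E = ΣV n (λ v → degree E v % 2)

-- linear arrangement: bijection vertices → positions (positions 0..n-1,
-- a shift of 1..n that does not affect lengths)
Arrangement : ℕ → Set
Arrangement n = Fin n ↔ Fin n

D : ∀ {n} → List (Edge n) → Arrangement n → ℕ
D E π = sum (map (λ e → ∣ toℕ (f (Data.Product.proj₁ e)) - toℕ (f (Data.Product.proj₂ e)) ∣) E)
  where f = Inverse.to π

-- Let p be the arrangement. Around a vertex v of degree k the neighbours sit at k
-- distinct positions other than p v; if l of them lie to the left and r = k − l
-- to the right, their distances to p v are at least 1,…,l and 1,…,r, so
--   4 · Σ_{u ~ v} |p v − p u| ≥ 2l(l+1) + 2r(r+1) ≥ k² + 2k + (k mod 2),
-- the last step being (l − r)² ≥ (l + r) mod 2. Summing over v counts every edge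
-- twice on the left, and Σ 2k_v = 4|E| ≥ 4(n − 1) because the tree is connected.
module Submission where

open import Defs
open import Data.Nat
  using (ℕ; zero; suc; _+_; _*_; _∸_; _≤_; _<_; _%_; ∣_-_∣; z≤n; s≤s; _≟_; _<?_)
open import Data.Nat.Properties
open import Data.Nat.DivMod using ([m+n]%n≡m%n; m%n≤m)
open import Data.Nat.ListAction using (sum)
open import Data.Nat.Tactic.RingSolver using (solve-∀)
open import Data.Fin using (Fin; toℕ) renaming (zero to fzero; suc to fsuc; _≟_ to _≟ᶠ_)
import Data.Fin.Properties as Fin
open import Data.List using (List; []; _∷_; map; length)
open import Data.List.Properties using (map-cong; map-∘; length-map)
open import Data.List.Relation.Unary.All as All using (All; []; _∷_)
import Data.List.Relation.Unary.All.Properties as All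
open import Data.List.Relation.Unary.AllPairs using (AllPairs; []; _∷_)
open import Data.List.Relation.Unary.Any using (here; there)
open import Data.List.Relation.Unary.Unique.Propositional using (Unique)
import Data.List.Relation.Unary.Unique.Propositional.Properties as Unique
open import Data.Product using (_×_; _,_; proj₁; proj₂; map₁)
open import Data.Sum using (_⊎_; inj₁; inj₂)
open import Function using (_∘_)
open import Function.Bundles using (Inverse; Injection)
open import Function.Properties.Inverse using (↔⇒↣)
open import Relation.Binary.Construct.Closure.ReflexiveTransitive using (Star; ε; _◅_)
open import Relation.Binary.PropositionalEquality
open import Relation.Nullary using (¬_; Dec; yes; no; contradiction)

[≟v]-≡ : ∀ {n} {a b : Fin n} → a ≡ b → [ a ≟v b ] ≡ 1
[≟v]-≡ {a = a} {b} a≡b with a ≟ᶠ b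
... | yes _   = refl
... | no  a≢b = contradiction a≡b a≢b

[≟v]-≢ : ∀ {n} {a b : Fin n} → a ≢ b → [ a ≟v b ] ≡ 0
[≟v]-≢ {a = a} {b} a≢b with a ≟ᶠ b
... | yes a≡b = contradiction a≡b a≢b
... | no  _   = refl

[≟v]≤1 : ∀ {n} (a b : Fin n) → [ a ≟v b ] ≤ 1
[≟v]≤1 a b with a ≟ᶠ b
... | yes _ = s≤s z≤n
... | no  _ = z≤n

[≟v]-pos⇒≡ : ∀ {n} {a b : Fin n} → 1 ≤ [ a ≟v b ] → a ≡ b
[≟v]-pos⇒≡ {a = a} {b} pos with a ≟ᶠ b
... | yes a≡b = a≡b
[≟v]-pos⇒≡ () | no _

[suc≟vsuc] : ∀ {n} (a b : Fin n) → [ fsuc a ≟v fsuc b ] ≡ [ a ≟v b ]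
[suc≟vsuc] a b = by-cases (a ≟ᶠ b)
  where
  by-cases : Dec (a ≡ b) → [ fsuc a ≟v fsuc b ] ≡ [ a ≟v b ]
  by-cases (yes a≡b) = trans ([≟v]-≡ (cong fsuc a≡b)) (sym ([≟v]-≡ a≡b))
  by-cases (no  a≢b) = trans ([≟v]-≢ (a≢b ∘ Fin.suc-injective)) (sym ([≟v]-≢ a≢b))

ΣV-cong : ∀ n {f g : Fin n → ℕ} → (∀ i → f i ≡ g i) → ΣV n f ≡ ΣV n g
ΣV-cong zero    f≗g = refl
ΣV-cong (suc n) f≗g = cong₂ _+_ (f≗g fzero) (ΣV-cong n (f≗g ∘ fsuc))

ΣV-mono-≤ : ∀ n {f g : Fin n → ℕ} → (∀ i → f i ≤ g i) → ΣV n f ≤ ΣV n g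
ΣV-mono-≤ zero    f≤g = z≤n
ΣV-mono-≤ (suc n) f≤g = +-mono-≤ (f≤g fzero) (ΣV-mono-≤ n (f≤g ∘ fsuc))

ΣV-distrib-+ : ∀ n (f g : Fin n → ℕ) → ΣV n (λ i → f i + g i) ≡ ΣV n f + ΣV n g
ΣV-distrib-+ zero    f g = refl
ΣV-distrib-+ (suc n) f g = begin
  f fzero + g fzero + ΣV n (λ i → f (fsuc i) + g (fsuc i))
    ≡⟨ cong (f fzero + g fzero +_) (ΣV-distrib-+ n (f ∘ fsuc) (g ∘ fsuc)) ⟩
  f fzero + g fzero + (ΣV n (f ∘ fsuc) + ΣV n (g ∘ fsuc))
    ≡⟨ +-interchange (f fzero) (g fzero) _ _ ⟩
  f fzero + ΣV n (f ∘ fsuc) + (g fzero + ΣV n (g ∘ fsuc)) ∎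
  where
  open ≡-Reasoning
  +-interchange : ∀ a b c d → a + b + (c + d) ≡ a + c + (b + d)
  +-interchange = solve-∀

ΣV-*ʳ : ∀ n (f : Fin n → ℕ) c → ΣV n (λ i → f i * c) ≡ ΣV n f * c
ΣV-*ʳ zero    f c = refl
ΣV-*ʳ (suc n) f c =
  trans (cong (f fzero * c +_) (ΣV-*ʳ n (f ∘ fsuc) c)) (sym (*-distribʳ-+ c (f fzero) _))

ΣV-*ˡ : ∀ n (f : Fin n → ℕ) c → ΣV n (λ i → c * f i) ≡ c * ΣV n f
ΣV-*ˡ n f c = trans (ΣV-cong n (λ i → *-comm c (f i))) (trans (ΣV-*ʳ n f c) (*-comm _ c))

ΣV-const : ∀ n c → ΣV n (λ _ → c) ≡ n * c
ΣV-const zero    c = refl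
ΣV-const (suc n) c = cong (c +_) (ΣV-const n c)

ΣV-zero : ∀ n → ΣV n (λ _ → 0) ≡ 0
ΣV-zero n = trans (ΣV-const n 0) (*-zeroʳ n)

ΣV-[≟v] : ∀ n (a : Fin n) → ΣV n (λ v → [ a ≟v v ]) ≡ 1
ΣV-[≟v] (suc n) fzero    = cong suc (ΣV-zero n)
ΣV-[≟v] (suc n) (fsuc a) = trans (ΣV-cong n ([suc≟vsuc] a)) (ΣV-[≟v] n a)

ΣV-sum-comm : ∀ {A : Set} n (g : Fin n → A → ℕ) (xs : List A) →
  ΣV n (λ v → sum (map (g v) xs)) ≡ sum (map (λ x → ΣV n (λ v → g v x)) xs)
ΣV-sum-comm n g []       = ΣV-zero n
ΣV-sum-comm n g (x ∷ xs) =
  trans (ΣV-distrib-+ n (λ v → g v x) (λ v → sum (map (g v) xs)))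
        (cong (ΣV n (λ v → g v x) +_) (ΣV-sum-comm n g xs))

ΣV-≤1 : ∀ n (f : Fin n → ℕ) → (∀ i → f i ≤ 1) →
  (∀ i j → 1 ≤ f i → 1 ≤ f j → i ≡ j) → ΣV n f ≤ 1
ΣV-≤1 zero    f f≤1 supp-unique = z≤n
ΣV-≤1 (suc n) f f≤1 supp-unique with 1 ≤? f fzero
... | no  f₀≱1 = +-mono-≤ (≤-reflexive (n<1⇒n≡0 (≰⇒> f₀≱1)))
                          (ΣV-≤1 n (f ∘ fsuc) (f≤1 ∘ fsuc) λ i j fᵢ fⱼ →
                            Fin.suc-injective (supp-unique (fsuc i) (fsuc j) fᵢ fⱼ))
... | yes f₀≥1 = +-mono-≤ (f≤1 fzero) (≤-reflexive (trans (ΣV-cong n rest-zero) (ΣV-zero n)))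
  where
  rest-zero : ∀ i → f (fsuc i) ≡ 0
  rest-zero i = n<1⇒n≡0 (≰⇒> (λ fᵢ≥1 → Fin.0≢1+n (supp-unique fzero (fsuc i) f₀≥1 fᵢ≥1)))

sum-map-*ˡ : ∀ {A : Set} c (f : A → ℕ) (xs : List A) →
  sum (map (λ x → c * f x) xs) ≡ c * sum (map f xs)
sum-map-*ˡ c f []       = sym (*-zeroʳ c)
sum-map-*ˡ c f (x ∷ xs) = trans (cong (c * f x +_) (sum-map-*ˡ c f xs)) (sym (*-distribˡ-+ c (f x) _))

sum-map-const : ∀ {A : Set} c (xs : List A) → sum (map (λ _ → c) xs) ≡ c * length xs
sum-map-const c []       = sym (*-zeroʳ c)
sum-map-const c (x ∷ xs) = trans (cong (c +_) (sum-map-const c xs)) (sym (*-suc c (length xs)))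

incidence : ∀ {n} → Fin n → Edge n → ℕ
incidence v e = [ proj₁ e ≟v v ] + [ proj₂ e ≟v v ]

ΣV-incidence : ∀ n (e : Edge n) → ΣV n (λ v → incidence v e) ≡ 2
ΣV-incidence n (a , b) =
  trans (ΣV-distrib-+ n _ _) (cong₂ _+_ (ΣV-[≟v] n a) (ΣV-[≟v] n b))

handshake : ∀ {n} (E : List (Edge n)) → ΣV n (degree E) ≡ 2 * length E
handshake {n} E = begin
  ΣV n (degree E)                                    ≡⟨ ΣV-sum-comm n incidence E ⟩
  sum (map (λ e → ΣV n (λ v → incidence v e)) E)   ≡⟨ cong sum (map-cong (ΣV-incidence n) E) ⟩
  sum (map (λ _ → 2) E)                              ≡⟨ sum-map-const 2 E ⟩
  2 * length E                                       ∎
  where open ≡-Reasoning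

ΣV-incidence-weighted : ∀ {n} (w : Edge n → ℕ) (E : List (Edge n)) →
  ΣV n (λ v → sum (map (λ e → incidence v e * w e) E)) ≡ 2 * sum (map w E)
ΣV-incidence-weighted {n} w E = begin
  ΣV n (λ v → sum (map (λ e → incidence v e * w e) E))
    ≡⟨ ΣV-sum-comm n (λ v e → incidence v e * w e) E ⟩
  sum (map (λ e → ΣV n (λ v → incidence v e * w e)) E)
    ≡⟨ cong sum (map-cong (λ e → trans (ΣV-*ʳ n _ (w e)) (cong (_* w e) (ΣV-incidence n e))) E) ⟩
  sum (map (λ e → 2 * w e) E)
    ≡⟨ sum-map-*ˡ 2 w E ⟩
  2 * sum (map w E) ∎
  where open ≡-Reasoning

roots : ∀ {n} → (Fin n → Fin n) → ℕ
roots {n} label = ΣV n (λ x → [ label x ≟v x ])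

-- A union–find labelling: each edge merges at most two classes, so at most one root is lost per edge.
record ComponentLabelling {n} (E : List (Edge n)) : Set where
  field
    label          : Fin n → Fin n
    label-resp-Adj : ∀ {u v} → Adj E u v → label u ≡ label v
    n≤roots+edges  : n ≤ roots label + length E

redirect : ∀ {n} → Fin n → Fin n → Fin n → Fin n
redirect target source y with y ≟ᶠ source
... | yes _ = target
... | no  _ = y

redirect-source : ∀ {n} (target source : Fin n) → redirect target source source ≡ target
redirect-source target source with source ≟ᶠ source
... | yes _               = refl
... | no  source≢source = contradiction refl source≢source

redirect-other : ∀ {n} {target source y : Fin n} → y ≢ source → redirect target source y ≡ y
redirect-other {target = target} {source} {y} y≢source with y ≟ᶠ source
... | yes y≡source = contradiction y≡source y≢source
... | no  _        = refl

redirect-target : ∀ {n} (target source : Fin n) → redirect target source target ≡ target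
redirect-target target source with target ≟ᶠ source
... | yes _ = refl
... | no  _ = refl

componentLabelling : ∀ {n} (E : List (Edge n)) → ComponentLabelling E
componentLabelling {n} [] = record
  { label          = λ x → x
  ; label-resp-Adj = λ { (inj₁ ()) ; (inj₂ ()) }
  ; n≤roots+edges  = ≤-reflexive (sym (begin
      roots {n} (λ x → x) + 0   ≡⟨ +-identityʳ _ ⟩
      roots {n} (λ x → x)       ≡⟨ ΣV-cong n (λ x → [≟v]-≡ refl) ⟩
      ΣV n (λ _ → 1)            ≡⟨ ΣV-const n 1 ⟩
      n * 1                     ≡⟨ *-identityʳ n ⟩
      n                         ∎))
  }
  where open ≡-Reasoning
componentLabelling {n} ((a , b) ∷ E) = record
  { label          = label′
  ; label-resp-Adj = label′-resp-Adj
  ; n≤roots+edges  = ≤-trans n≤roots+edges (begin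
      roots label + length E            ≤⟨ +-monoˡ-≤ (length E) roots-lost≤1 ⟩
      suc (roots label′) + length E     ≡⟨ +-suc (roots label′) (length E) ⟨
      roots label′ + suc (length E)     ∎)
  }
  where
  open ComponentLabelling (componentLabelling E)
  open ≤-Reasoning
  label′ : Fin n → Fin n
  label′ = redirect (label a) (label b) ∘ label

  merged : label′ a ≡ label′ b
  merged = trans (redirect-target (label a) (label b)) (sym (redirect-source (label a) (label b)))

  label′-resp-Adj : ∀ {u v} → Adj ((a , b) ∷ E) u v → label′ u ≡ label′ v
  label′-resp-Adj (inj₁ (here refl))  = merged
  label′-resp-Adj (inj₂ (here refl))  = sym merged
  label′-resp-Adj (inj₁ (there uv∈E)) = cong (redirect (label a) (label b)) (label-resp-Adj (inj₁ uv∈E))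
  label′-resp-Adj (inj₂ (there vu∈E)) = cong (redirect (label a) (label b)) (label-resp-Adj (inj₂ vu∈E))

  root-kept : ∀ x → [ label x ≟v x ] ≤ [ label′ x ≟v x ] + [ label b ≟v x ]
  root-kept x = by-cases (label x ≟ᶠ x) (label x ≟ᶠ label b)
    where
    by-cases : Dec (label x ≡ x) → Dec (label x ≡ label b) →
               [ label x ≟v x ] ≤ [ label′ x ≟v x ] + [ label b ≟v x ]
    by-cases (no  lx≢x) _           = ≤-trans (≤-reflexive ([≟v]-≢ lx≢x)) z≤n
    by-cases (yes lx≡x) (yes lx≡lb) = ≤-trans ([≟v]≤1 _ _)
      (≤-trans (≤-reflexive (sym ([≟v]-≡ (trans (sym lx≡lb) lx≡x)))) (m≤n+m _ _))
    by-cases (yes lx≡x) (no  lx≢lb) = ≤-trans ([≟v]≤1 _ _)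
      (≤-trans (≤-reflexive (sym ([≟v]-≡ (trans (redirect-other lx≢lb) lx≡x)))) (m≤m+n _ _))

  roots-lost≤1 : roots label ≤ suc (roots label′)
  roots-lost≤1 = begin
    roots label                                         ≤⟨ ΣV-mono-≤ n root-kept ⟩
    ΣV n (λ x → [ label′ x ≟v x ] + [ label b ≟v x ])   ≡⟨ ΣV-distrib-+ n _ _ ⟩
    roots label′ + ΣV n (λ x → [ label b ≟v x ])        ≡⟨ cong (roots label′ +_) (ΣV-[≟v] n (label b)) ⟩
    roots label′ + 1                                    ≡⟨ +-comm (roots label′) 1 ⟩
    suc (roots label′)                                  ∎

connected⇒n∸1≤length : ∀ {n} (E : List (Edge n)) → Connected E → n ∸ 1 ≤ length E
connected⇒n∸1≤length {n} E connected =
  ∸-monoˡ-≤ 1 (≤-trans n≤roots+edges (+-monoˡ-≤ (length E) roots≤1))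
  where
  open ComponentLabelling (componentLabelling E)
  label-resp-Star : ∀ {u v} → Star (Adj E) u v → label u ≡ label v
  label-resp-Star ε        = refl
  label-resp-Star (uv ◅ p) = trans (label-resp-Adj uv) (label-resp-Star p)
  roots≤1 : roots label ≤ 1
  roots≤1 = ΣV-≤1 n _ (λ x → [≟v]≤1 (label x) x) λ x y x-root y-root →
    trans (sym ([≟v]-pos⇒≡ x-root))
          (trans (label-resp-Star (connected x y)) ([≟v]-pos⇒≡ y-root))

_without_ : List ℕ → ℕ → List ℕ
[]       without m = []
(x ∷ xs) without m with x ≟ m
... | yes _ = xs
... | no  _ = x ∷ xs without m

without-All : ∀ {P : ℕ → Set} m xs → All P xs → All P (xs without m)
without-All m []       []         = []
without-All m (x ∷ xs) (px ∷ pxs) with x ≟ m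
... | yes _ = pxs
... | no  _ = px ∷ without-All m xs pxs

without-Unique : ∀ m xs → Unique xs → Unique (xs without m)
without-Unique m []       []           = []
without-Unique m (x ∷ xs) (x∉xs ∷ uxs) with x ≟ m
... | yes _ = uxs
... | no  _ = without-All m xs x∉xs ∷ without-Unique m xs uxs

without-removes : ∀ m xs → Unique xs → All (_≢ m) (xs without m)
without-removes m []       []           = []
without-removes m (x ∷ xs) (x∉xs ∷ uxs) with x ≟ m
... | yes refl = All.map (λ x≢y y≡x → x≢y (sym y≡x)) x∉xs
... | no  x≢m  = x≢m ∷ without-removes m xs uxs

without-cases : ∀ m xs →
  All (_≢ m) xs ⊎ (length xs ≡ suc (length (xs without m)) × sum xs ≡ m + sum (xs without m))
without-cases m []       = inj₁ []
without-cases m (x ∷ xs) with x ≟ m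
... | yes refl = inj₂ (refl , refl)
... | no  x≢m with without-cases m xs
...   | inj₁ xs≢m          = inj₁ (x≢m ∷ xs≢m)
...   | inj₂ (len≡ , sum≡) = inj₂ (cong suc len≡ , trans (cong (x +_) sum≡) (+-left-comm x m _))
  where
  +-left-comm : ∀ a b c → a + (b + c) ≡ b + (a + c)
  +-left-comm = solve-∀

Within : ℕ → ℕ → Set
Within N d = 1 ≤ d × d ≤ N

Within-pred : ∀ N {xs} → All (_≢ suc N) xs → All (Within (suc N)) xs → All (Within N) xs
Within-pred N xs≢N xs∈[1,N+1] = All.zipWith
  (λ { (d≢N , 1≤d , d≤N+1) → 1≤d , ≤-pred (≤∧≢⇒< d≤N+1 d≢N) })
  (xs≢N , xs∈[1,N+1])

-- The conjunct length ds ≤ N is what lets the removed top value N dominate the new term 2(k + 1).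
distinct-within-sum : ∀ N ds → Unique ds → All (Within N) ds →
  length ds ≤ N × length ds * suc (length ds) ≤ 2 * sum ds
distinct-within-sum zero    []       _ _                  = z≤n , z≤n
distinct-within-sum zero    (d ∷ ds) _ ((1≤d , d≤0) ∷ _) = contradiction (≤-trans 1≤d d≤0) λ ()
distinct-within-sum (suc N) ds uds ds∈[1,N+1] with without-cases (suc N) ds
... | inj₁ ds≢N+1 = map₁ m≤n⇒m≤1+n (distinct-within-sum N ds uds (Within-pred N ds≢N+1 ds∈[1,N+1]))
... | inj₂ (len≡ , sum≡) rewrite len≡ | sum≡ =
  s≤s k≤N , (begin
    suc k * suc (suc k)       ≡⟨ triangular-step k ⟩
    k * suc k + 2 * suc k     ≤⟨ +-mono-≤ k[k+1]≤2t (*-monoʳ-≤ 2 (s≤s k≤N)) ⟩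
    2 * t + 2 * suc N         ≡⟨ *-distribˡ-+ 2 t (suc N) ⟨
    2 * (t + suc N)           ≡⟨ cong (2 *_) (+-comm t (suc N)) ⟩
    2 * (suc N + t)           ∎)
  where
  open ≤-Reasoning
  ds′ = ds without suc N
  k = length ds′
  t = sum ds′
  IH = distinct-within-sum N ds′ (without-Unique (suc N) ds uds)
         (Within-pred N (without-removes (suc N) ds uds) (without-All (suc N) ds ds∈[1,N+1]))
  k≤N = proj₁ IH
  k[k+1]≤2t = proj₂ IH
  triangular-step : ∀ k → suc k * suc (suc k) ≡ k * suc k + 2 * suc k
  triangular-step = solve-∀

All≤sum : ∀ ds → All (_≤ sum ds) ds
All≤sum []       = []
All≤sum (d ∷ ds) = m≤m+n d (sum ds) ∷ All.map (λ d′≤ → ≤-trans d′≤ (m≤n+m (sum ds) d)) (All≤sum ds)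

distinct-positive-sum : ∀ ds → Unique ds → All (1 ≤_) ds → length ds * suc (length ds) ≤ 2 * sum ds
distinct-positive-sum ds uds ds≥1 =
  proj₂ (distinct-within-sum (sum ds) ds uds (All.zip (ds≥1 , All≤sum ds)))

leftGaps : ℕ → List ℕ → List ℕ
leftGaps c []       = []
leftGaps c (y ∷ ys) with y <? c
... | yes _ = c ∸ y ∷ leftGaps c ys
... | no  _ = leftGaps c ys

rightGaps : ℕ → List ℕ → List ℕ
rightGaps c []       = []
rightGaps c (y ∷ ys) with c <? y
... | yes _ = y ∸ c ∷ rightGaps c ys
... | no  _ = rightGaps c ys

sum-distances-split : ∀ c ys →
  sum (map (λ y → ∣ c - y ∣) ys) ≡ sum (leftGaps c ys) + sum (rightGaps c ys)
sum-distances-split c []       = refl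
sum-distances-split c (y ∷ ys) with y <? c | c <? y
... | yes y<c | yes c<y = contradiction c<y (<-asym y<c)
... | yes y<c | no  _   = trans (cong₂ _+_ (m≤n⇒∣n-m∣≡n∸m (<⇒≤ y<c)) (sum-distances-split c ys))
                                (sym (+-assoc (c ∸ y) _ _))
... | no  _   | yes c<y = trans (cong₂ _+_ (m≤n⇒∣m-n∣≡n∸m (<⇒≤ c<y)) (sum-distances-split c ys))
                                (+-left-comm (y ∸ c) (sum (leftGaps c ys)) (sum (rightGaps c ys)))
  where
  +-left-comm : ∀ a b d → a + (b + d) ≡ b + (a + d)
  +-left-comm = solve-∀
... | no  y≮c | no  c≮y =
  trans (cong (_+ _) (m≡n⇒∣m-n∣≡0 (≤-antisym (≮⇒≥ y≮c) (≮⇒≥ c≮y)))) (sum-distances-split c ys)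

length-split : ∀ c ys → All (_≢ c) ys → length ys ≡ length (leftGaps c ys) + length (rightGaps c ys)
length-split c []       []            = refl
length-split c (y ∷ ys) (y≢c ∷ ys≢c) with y <? c | c <? y
... | yes y<c | yes c<y = contradiction c<y (<-asym y<c)
... | yes _   | no  _   = cong suc (length-split c ys ys≢c)
... | no  _   | yes _   = trans (cong suc (length-split c ys ys≢c)) (sym (+-suc _ _))
... | no  y≮c | no  c≮y = contradiction (≤-antisym (≮⇒≥ c≮y) (≮⇒≥ y≮c)) y≢c

leftGaps-fresh : ∀ c {y} ys → y < c → All (y ≢_) ys → All (c ∸ y ≢_) (leftGaps c ys)
leftGaps-fresh c []       y<c []             = []
leftGaps-fresh c (z ∷ ys) y<c (y≢z ∷ y∉ys) with z <? c
... | yes z<c = (y≢z ∘ ∸-cancelˡ-≡ (<⇒≤ y<c) (<⇒≤ z<c)) ∷ leftGaps-fresh c ys y<c y∉ys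
... | no  _   = leftGaps-fresh c ys y<c y∉ys

rightGaps-fresh : ∀ c {y} ys → c < y → All (y ≢_) ys → All (y ∸ c ≢_) (rightGaps c ys)
rightGaps-fresh c []       c<y []             = []
rightGaps-fresh c (z ∷ ys) c<y (y≢z ∷ y∉ys) with c <? z
... | yes c<z = (y≢z ∘ ∸-cancelʳ-≡ (<⇒≤ c<y) (<⇒≤ c<z)) ∷ rightGaps-fresh c ys c<y y∉ys
... | no  _   = rightGaps-fresh c ys c<y y∉ys

leftGaps-Unique : ∀ c ys → Unique ys → Unique (leftGaps c ys)
leftGaps-Unique c []       []           = []
leftGaps-Unique c (y ∷ ys) (y∉ys ∷ uys) with y <? c
... | yes y<c = leftGaps-fresh c ys y<c y∉ys ∷ leftGaps-Unique c ys uys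
... | no  _   = leftGaps-Unique c ys uys

rightGaps-Unique : ∀ c ys → Unique ys → Unique (rightGaps c ys)
rightGaps-Unique c []       []           = []
rightGaps-Unique c (y ∷ ys) (y∉ys ∷ uys) with c <? y
... | yes c<y = rightGaps-fresh c ys c<y y∉ys ∷ rightGaps-Unique c ys uys
... | no  _   = rightGaps-Unique c ys uys

leftGaps-positive : ∀ c ys → All (1 ≤_) (leftGaps c ys)
leftGaps-positive c []       = []
leftGaps-positive c (y ∷ ys) with y <? c
... | yes y<c = m<n⇒0<n∸m y<c ∷ leftGaps-positive c ys
... | no  _   = leftGaps-positive c ys

rightGaps-positive : ∀ c ys → All (1 ≤_) (rightGaps c ys)
rightGaps-positive c []       = []
rightGaps-positive c (y ∷ ys) with c <? y
... | yes c<y = m<n⇒0<n∸m c<y ∷ rightGaps-positive c ys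
... | no  _   = rightGaps-positive c ys

m%2≤m*m : ∀ m → m % 2 ≤ m * m
m%2≤m*m zero    = z≤n
m%2≤m*m (suc m) = ≤-trans (m%n≤m (suc m) 2) (m≤m*n (suc m) (suc m))

-- A discrete form of (m − n)² ≥ 0 that keeps track of parity: (m − n)² ≡ m + n (mod 2).
[m+n]%2+2mn≤m²+n² : ∀ m n → (m + n) % 2 + 2 * (m * n) ≤ m * m + n * n
[m+n]%2+2mn≤m²+n² zero    n       = ≤-trans (≤-reflexive (+-identityʳ (n % 2))) (m%2≤m*m n)
[m+n]%2+2mn≤m²+n² (suc m) zero    = begin
  (suc m + 0) % 2 + 2 * (suc m * 0)
    ≡⟨ cong₂ (λ a b → a % 2 + 2 * b) (+-identityʳ (suc m)) (*-zeroʳ (suc m)) ⟩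
  suc m % 2 + 0                        ≡⟨ +-identityʳ _ ⟩
  suc m % 2                            ≤⟨ m%2≤m*m (suc m) ⟩
  suc m * suc m                        ≡⟨ +-identityʳ _ ⟨
  suc m * suc m + 0                    ∎
  where open ≤-Reasoning
[m+n]%2+2mn≤m²+n² (suc m) (suc n) = begin
  (suc m + suc n) % 2 + 2 * (suc m * suc n)
    ≡⟨ cong₂ _+_ (trans (cong (_% 2) (sum-step m n)) ([m+n]%n≡m%n (m + n) 2)) (product-step m n) ⟩
  (m + n) % 2 + (2 * (m * n) + d)      ≡⟨ +-assoc ((m + n) % 2) _ d ⟨
  (m + n) % 2 + 2 * (m * n) + d        ≤⟨ +-monoˡ-≤ d ([m+n]%2+2mn≤m²+n² m n) ⟩
  m * m + n * n + d                    ≡⟨ squares-step m n ⟩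
  suc m * suc m + suc n * suc n        ∎
  where
  open ≤-Reasoning
  d = 2 * m + 2 * n + 2
  sum-step : ∀ m n → suc m + suc n ≡ m + n + 2
  sum-step = solve-∀
  product-step : ∀ m n → 2 * (suc m * suc n) ≡ 2 * (m * n) + (2 * m + 2 * n + 2)
  product-step = solve-∀
  squares-step : ∀ m n → m * m + n * n + (2 * m + 2 * n + 2) ≡ suc m * suc m + suc n * suc n
  squares-step = solve-∀

two-sided-triangular : ∀ l r →
  (l + r) * (l + r) + 2 * (l + r) + (l + r) % 2 ≤ 2 * (l * suc l) + 2 * (r * suc r)
two-sided-triangular l r = begin
  (l + r) * (l + r) + 2 * (l + r) + (l + r) % 2
    ≡⟨ expand l r ((l + r) % 2) ⟩
  l * l + r * r + 2 * l + 2 * r + ((l + r) % 2 + 2 * (l * r))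
    ≤⟨ +-monoʳ-≤ (l * l + r * r + 2 * l + 2 * r) ([m+n]%2+2mn≤m²+n² l r) ⟩
  l * l + r * r + 2 * l + 2 * r + (l * l + r * r)
    ≡⟨ collect l r ⟩
  2 * (l * suc l) + 2 * (r * suc r) ∎
  where
  open ≤-Reasoning
  expand : ∀ l r p → (l + r) * (l + r) + 2 * (l + r) + p ≡ l * l + r * r + 2 * l + 2 * r + (p + 2 * (l * r))
  expand = solve-∀
  collect : ∀ l r → l * l + r * r + 2 * l + 2 * r + (l * l + r * r) ≡ 2 * (l * suc l) + 2 * (r * suc r)
  collect = solve-∀

distance-sum-bound : ∀ c ys → Unique ys → All (_≢ c) ys →
  let k = length ys in k * k + 2 * k + k % 2 ≤ 4 * sum (map (λ y → ∣ c - y ∣) ys)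
distance-sum-bound c ys uys ys≢c
  rewrite length-split c ys ys≢c | sum-distances-split c ys = begin
    (l + r) * (l + r) + 2 * (l + r) + (l + r) % 2
      ≤⟨ two-sided-triangular l r ⟩
    2 * (l * suc l) + 2 * (r * suc r)
      ≤⟨ +-mono-≤ (*-monoʳ-≤ 2 left-bound) (*-monoʳ-≤ 2 right-bound) ⟩
    2 * (2 * sum (leftGaps c ys)) + 2 * (2 * sum (rightGaps c ys))
      ≡⟨ regroup (sum (leftGaps c ys)) (sum (rightGaps c ys)) ⟩
    4 * (sum (leftGaps c ys) + sum (rightGaps c ys)) ∎
  where
  open ≤-Reasoning
  l = length (leftGaps c ys)
  r = length (rightGaps c ys)
  left-bound : l * suc l ≤ 2 * sum (leftGaps c ys)
  left-bound = distinct-positive-sum _ (leftGaps-Unique c ys uys) (leftGaps-positive c ys)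
  right-bound : r * suc r ≤ 2 * sum (rightGaps c ys)
  right-bound = distinct-positive-sum _ (rightGaps-Unique c ys uys) (rightGaps-positive c ys)
  regroup : ∀ a b → 2 * (2 * a) + 2 * (2 * b) ≡ 4 * (a + b)
  regroup = solve-∀

Loopless : ∀ {n} → List (Edge n) → Set
Loopless E = All (λ e → proj₁ e ≢ proj₂ e) E

SameEdge-swap : ∀ {n} {a b : Fin n} (f : Edge n) → SameEdge (a , b) f → SameEdge (b , a) f
SameEdge-swap f (inj₁ (a≡c , b≡d)) = inj₂ (b≡d , a≡c)
SameEdge-swap f (inj₂ (a≡d , b≡c)) = inj₁ (b≡c , a≡d)

neighbours : ∀ {n} → Fin n → List (Edge n) → List (Fin n)
neighbours v []            = []
neighbours v ((a , b) ∷ E) with a ≟ᶠ v | b ≟ᶠ v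
... | yes _ | _     = b ∷ neighbours v E
... | no  _ | yes _ = a ∷ neighbours v E
... | no  _ | no  _ = neighbours v E

degree≡length-neighbours : ∀ {n} (v : Fin n) E → Loopless E → degree E v ≡ length (neighbours v E)
degree≡length-neighbours v []            []         = refl
degree≡length-neighbours v ((a , b) ∷ E) (a≢b ∷ nl) with a ≟ᶠ v | b ≟ᶠ v
... | yes a≡v | yes b≡v = contradiction (trans a≡v (sym b≡v)) a≢b
... | yes _   | no  _   = cong suc (degree≡length-neighbours v E nl)
... | no  _   | yes _   = cong suc (degree≡length-neighbours v E nl)
... | no  _   | no  _   = degree≡length-neighbours v E nl

edgeLength : ∀ {n} → (Fin n → ℕ) → Edge n → ℕ
edgeLength p e = ∣ p (proj₁ e) - p (proj₂ e) ∣

incidentLength : ∀ {n} → (Fin n → ℕ) → List (Edge n) → Fin n → ℕ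
incidentLength p E v = sum (map (λ e → incidence v e * edgeLength p e) E)

incidentLength≡neighbour-distances : ∀ {n} (p : Fin n → ℕ) v E → Loopless E →
  incidentLength p E v ≡ sum (map (λ u → ∣ p v - p u ∣) (neighbours v E))
incidentLength≡neighbour-distances p v []            []         = refl
incidentLength≡neighbour-distances p v ((a , b) ∷ E) (a≢b ∷ nl) with a ≟ᶠ v | b ≟ᶠ v
... | yes a≡v  | yes b≡v = contradiction (trans a≡v (sym b≡v)) a≢b
... | yes refl | no  _   = cong₂ _+_ (+-identityʳ _) (incidentLength≡neighbour-distances p v E nl)
... | no  _    | yes refl = cong₂ _+_ (trans (+-identityʳ _) (∣-∣-comm (p a) (p v)))
                                      (incidentLength≡neighbour-distances p v E nl)
... | no  _    | no  _   = incidentLength≡neighbour-distances p v E nl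

neighbours-fresh : ∀ {n} (v w : Fin n) E →
  All (λ f → ¬ SameEdge (v , w) f) E → All (w ≢_) (neighbours v E)
neighbours-fresh v w []            []             = []
neighbours-fresh v w ((a , b) ∷ E) (new ∷ news) with a ≟ᶠ v | b ≟ᶠ v
... | yes refl | _        = (λ w≡b → new (inj₁ (refl , w≡b))) ∷ neighbours-fresh v w E news
... | no  _    | yes refl = (λ w≡a → new (inj₂ (refl , w≡a))) ∷ neighbours-fresh v w E news
... | no  _    | no  _    = neighbours-fresh v w E news

neighbours-Unique : ∀ {n} (v : Fin n) E → AllPairs (λ e f → ¬ SameEdge e f) E → Unique (neighbours v E)
neighbours-Unique v []            []           = []
neighbours-Unique v ((a , b) ∷ E) (new ∷ news) with a ≟ᶠ v | b ≟ᶠ v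
... | yes refl | _        = neighbours-fresh v b E new ∷ neighbours-Unique v E news
... | no  _    | yes refl =
  neighbours-fresh v a E (All.map (λ {f} ¬same → ¬same ∘ SameEdge-swap f) new) ∷ neighbours-Unique v E news
... | no  _    | no  _    = neighbours-Unique v E news

neighbours-≢ : ∀ {n} (v : Fin n) E → Loopless E → All (_≢ v) (neighbours v E)
neighbours-≢ v []            []         = []
neighbours-≢ v ((a , b) ∷ E) (a≢b ∷ nl) with a ≟ᶠ v | b ≟ᶠ v
... | yes refl | _        = (a≢b ∘ sym) ∷ neighbours-≢ v E nl
... | no  _    | yes refl = a≢b ∷ neighbours-≢ v E nl
... | no  _    | no  _    = neighbours-≢ v E nl

vertex-bound : ∀ {n} {E : List (Edge n)} → Simple E →
  (p : Fin n → ℕ) → (∀ {x y} → p x ≡ p y → x ≡ y) → ∀ v →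
  let k = degree E v in k * k + 2 * k + k % 2 ≤ 4 * incidentLength p E v
vertex-bound {E = E} (loopless , distinct) p p-injective v = begin
  k * k + 2 * k + k % 2
    ≡⟨ cong (λ k → k * k + 2 * k + k % 2)
            (trans (degree≡length-neighbours v E loopless) (sym (length-map p ns))) ⟩
  length ys * length ys + 2 * length ys + length ys % 2
    ≤⟨ distance-sum-bound (p v) ys (Unique.map⁺ p-injective (neighbours-Unique v E distinct))
                          (All.map⁺ (All.map (_∘ p-injective) (neighbours-≢ v E loopless))) ⟩
  4 * sum (map (λ y → ∣ p v - y ∣) ys)
    ≡⟨ cong (λ xs → 4 * sum xs) (map-∘ ns) ⟨
  4 * sum (map (λ u → ∣ p v - p u ∣) ns)
    ≡⟨ cong (4 *_) (incidentLength≡neighbour-distances p v E loopless) ⟨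
  4 * incidentLength p E v ∎
  where
  open ≤-Reasoning
  k = degree E v
  ns = neighbours v E
  ys = map p ns

connected⇒4[n∸1]≤Σ2degree : ∀ {n} (E : List (Edge n)) → Connected E →
  4 * (n ∸ 1) ≤ ΣV n (λ v → 2 * degree E v)
connected⇒4[n∸1]≤Σ2degree {n} E connected = begin
  4 * (n ∸ 1)                    ≤⟨ *-monoʳ-≤ 4 (connected⇒n∸1≤length E connected) ⟩
  4 * length E                   ≡⟨ *-assoc 2 2 (length E) ⟩
  2 * (2 * length E)             ≡⟨ cong (2 *_) (handshake E) ⟨
  2 * ΣV n (degree E)            ≡⟨ ΣV-*ˡ n (degree E) 2 ⟨
  ΣV n (λ v → 2 * degree E v)    ∎
  where open ≤-Reasoning

position : ∀ {n} → Arrangement n → Fin n → ℕ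
position π = toℕ ∘ Inverse.to π

position-injective : ∀ {n} (π : Arrangement n) {x y : Fin n} → position π x ≡ position π y → x ≡ y
position-injective π = Injection.injective (↔⇒↣ π) ∘ Fin.toℕ-injective

theorem2 : (n : ℕ) → 1 ≤ n → (E : List (Edge n)) → IsTree E →
    (π : Arrangement n) →
    sumSqDeg E + 4 * (n ∸ 1) + numOddDeg E ≤ 8 * D E π
theorem2 n _ E (simple , connected , _) π = begin
  sumSqDeg E + 4 * (n ∸ 1) + numOddDeg E
    ≤⟨ +-monoˡ-≤ (numOddDeg E) (+-monoʳ-≤ (sumSqDeg E) (connected⇒4[n∸1]≤Σ2degree E connected)) ⟩
  sumSqDeg E + ΣV n (λ v → 2 * k v) + numOddDeg E
    ≡⟨ trans (ΣV-distrib-+ n _ _) (cong (_+ numOddDeg E) (ΣV-distrib-+ n _ _)) ⟨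
  ΣV n (λ v → k v * k v + 2 * k v + k v % 2)
    ≤⟨ ΣV-mono-≤ n (vertex-bound simple p (position-injective π)) ⟩
  ΣV n (λ v → 4 * incidentLength p E v)
    ≡⟨ ΣV-*ˡ n (incidentLength p E) 4 ⟩
  4 * ΣV n (incidentLength p E)
    ≡⟨ cong (4 *_) (ΣV-incidence-weighted (edgeLength p) E) ⟩
  4 * (2 * D E π)
    ≡⟨ *-assoc 4 2 (D E π) ⟨
  8 * D E π ∎
  where
  open ≤-Reasoning
  k = degree E
  p = position π
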